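{- Let $\mathcal{M}$ be a simple oriented matroid on $E_m=\{1,\dots,m\}$ with covector set $\mathcal{L}$ and tope set $\mathcal{T}$, and let $\boldsymbol{R}=(T^0,T^1,\dots,T^{2m-1},T^0)$ be a symmetric cycle in the tope graph of $\mathcal{M}$, with vertex set $V:=\{T^0,\dots,T^{2m-1}\}$. Then the set $\mathcal{K}^{\ast}:=\mathrm{max}^+(V)$ coincides with $$\bigl\{T\in V:\ \text{for all } S\in V,\ e\in E_m,\ \mathbf{S}(S,T)=\{e\}\Rightarrow T(e)=+\bigr\},$$ and it is a critical tope committee for $\mathcal{M}$ satisfying $|\{K\in\mathcal{K}^{\ast}:K(e)=+\}|=\lceil|\mathcal{K}^{\ast}|/2\rceil$ for every $e\in E_m$.
   Context: Standing assumption: oriented matroids have rank at least $2$. An oriented matroid on $E$ is given by its covector set $\mathcal{L}\subseteq\{ -,0,+\}^E$; topes are covectors of inclusion-maximal support; $X^+:=\{e:X(e)=+\}$; $\mathbf{S}(X,Y):=\{e:X(e)=-Y(e)\ne0\}$. Simple: no loops, no parallel and no antiparallel elements. The tope graph has the topes as vertices, two topes adjacent iff they cover a common subtope in the covector face lattice; for simple oriented matroids this means $|\mathbf{S}(T,T')|=1$. A cycle $(T^0,\dots,T^{2m-1},T^0)$ in the tope graph ($m=|E|$) is symmetric if $T^{k+m}=-T^k$ for $0\le k\le m-1$. $\mathrm{max}^+(\mathcal{P})$ is the set of $P\in\mathcal{P}$ whose positive part is inclusion-maximal in $\{R^+:R\in\mathcal{P}\}$. A tope committee is $\mathcal{K}^{\ast}\subset\mathcal{T}$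 with $|\{K\in\mathcal{K}^{\ast}:K(e)=+\}|>\tfrac12|\mathcal{K}^{\ast}|$ for all $e$; minimal if no proper subset is a tope committee; a minimal committee is critical if for all $K\in\mathcal{K}^{\ast}$ and $T\in\mathcal{T}$ with $T^+\subsetneqq K^+$, $(\mathcal{K}^{\ast}-\{K\})\cup\{T\}$ is not a tope committee. -}

module Defs where

open import Data.Nat using (ℕ; zero; suc; _+_; _*_; _<_; ⌈_/2⌉)
open import Data.Fin using (Fin; toℕ)
open import Data.Vec using (Vec; lookup; replicate; map; zipWith)
open import Data.List using (List; length)
open import Data.List.Membership.Propositional using (_∈_)
open import Data.List.Relation.Unary.Unique.Propositional using (Unique)
open import Data.Product using (Σ; ∃; ∃-syntax; _×_; _,_)
open import Data.Sum using (_⊎_)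
open import Relation.Nullary using (¬_)
open import Relation.Binary.PropositionalEquality using (_≡_; _≢_)
open import Function.Bundles using (_⇔_)

data Sign : Set where
  minus zer plus : Sign

negS : Sign → Sign
negS minus = plus
negS zer   = zer
negS plus  = minus

compS : Sign → Sign → Sign
compS zer b = b
compS a   _ = a

SV : ℕ → Set
SV m = Vec Sign m

neg : ∀ {m} → SV m → SV m
neg = map negS

_∘ₛ_ : ∀ {m} → SV m → SV m → SV m
_∘ₛ_ = zipWith compS

zeroV : ∀ m → SV m
zeroV m = replicate m zer

Sep : ∀ {m} → SV m → SV m → Fin m → Set
Sep X Y e = (lookup X e ≡ negS (lookup Y e)) × (lookup X e ≢ zer)

_≼_ : ∀ {m} → SV m → SV m → Set
X ≼ Y = ∀ e → (lookup X e ≡ zer) ⊎ (lookup X e ≡ lookup Y e)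

_≺_ : ∀ {m} → SV m → SV m → Set
X ≺ Y = (X ≼ Y) × (X ≢ Y)

record IsOrientedMatroid {m : ℕ} (L : SV m → Set) : Set where
  field
    L0 : L (zeroV m)
    L1 : ∀ X → L X → L (neg X)
    L2 : ∀ X Y → L X → L Y → L (X ∘ₛ Y)
    L3 : ∀ X Y e → L X → L Y → Sep X Y e →
         ∃[ Z ] (L Z × (lookup Z e ≡ zer) ×
                 (∀ f → ¬ Sep X Y f → lookup Z f ≡ lookup (X ∘ₛ Y) f))

-- rank ≥ 2: there is a chain 0 < X < Y of covectors
-- (the face lattice of a rank r oriented matroid has chains 0 < X1 < ... < Xr in L)
RankAtLeast2 : ∀ {m} → (SV m → Set) → Set
RankAtLeast2 L = ∃[ X ] ∃[ Y ] (L X × L Y × (zeroV _ ≺ X) × (X ≺ Y))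

-- simple: no loops, no parallel, no antiparallel elements
Simple : ∀ {m} → (SV m → Set) → Set
Simple {m} L =
  (∀ e → ∃[ X ] (L X × lookup X e ≢ zer)) ×
  (∀ (e f : Fin m) → e ≢ f → ∃[ X ] (L X × lookup X e ≢ lookup X f)) ×
  (∀ (e f : Fin m) → e ≢ f → ∃[ X ] (L X × lookup X e ≢ negS (lookup X f)))

_⊆supp_ : ∀ {m} → SV m → SV m → Set
X ⊆supp Y = ∀ e → lookup X e ≢ zer → lookup Y e ≢ zer

_⊊supp_ : ∀ {m} → SV m → SV m → Set
X ⊊supp Y = (X ⊆supp Y) × ∃[ e ] (lookup X e ≡ zer × lookup Y e ≢ zer)

Tope : ∀ {m} → (SV m → Set) → SV m → Set
Tope L T = L T × (∀ Y → L Y → ¬ (T ⊊supp Y))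

Covers : ∀ {m} → (SV m → Set) → SV m → SV m → Set
Covers L X Y = (X ≺ Y) × (∀ Z → L Z → X ≺ Z → ¬ (Z ≺ Y))

Adjacent : ∀ {m} → (SV m → Set) → SV m → SV m → Set
Adjacent L T T' = Tope L T × Tope L T' × T ≢ T' ×
                  ∃[ X ] (L X × Covers L X T × Covers L X T')

record SymmetricCycle {m : ℕ} (L : SV m → Set) (T : Fin (m + m) → SV m) : Set where
  field
    topes     : ∀ k → Tope L (T k)
    distinct  : ∀ i j → T i ≡ T j → i ≡ j
    adjacent  : ∀ i j → (toℕ j ≡ suc (toℕ i)) ⊎ ((toℕ j ≡ 0) × (suc (toℕ i) ≡ m + m)) →
                Adjacent L (T i) (T j)
    symmetric : ∀ i j → toℕ j ≡ toℕ i + m → T j ≡ neg (T i)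

_⊆⁺_ : ∀ {m} → SV m → SV m → Set
X ⊆⁺ Y = ∀ e → lookup X e ≡ plus → lookup Y e ≡ plus

_⊊⁺_ : ∀ {m} → SV m → SV m → Set
X ⊊⁺ Y = (X ⊆⁺ Y) × ∃[ e ] (lookup Y e ≡ plus × lookup X e ≢ plus)

maxPlus : ∀ {m} → (SV m → Set) → SV m → Set
maxPlus P X = P X × (∀ R → P R → ¬ (X ⊊⁺ R))

HasSize : ∀ {m} → (SV m → Set) → ℕ → Set
HasSize {m} P n = ∃[ xs ] (Unique xs × length {A = SV m} xs ≡ n × (∀ x → (x ∈ xs) ⇔ P x))

TopeCommittee : ∀ {m} → (SV m → Set) → (SV m → Set) → Set
TopeCommittee {m} L K =
  (∀ X → K X → Tope L X) ×
  ∃[ n ] (HasSize K n ×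
          (∀ (e : Fin m) → ∃[ k ] (HasSize (λ X → K X × lookup X e ≡ plus) k × n < 2 * k)))

_⊂ₚ_ : ∀ {m} → (SV m → Set) → (SV m → Set) → Set
Q ⊂ₚ K = (∀ X → Q X → K X) × ∃[ X ] (K X × ¬ Q X)

MinimalCommittee : ∀ {m} → (SV m → Set) → (SV m → Set) → Set₁
MinimalCommittee L K = TopeCommittee L K × (∀ Q → Q ⊂ₚ K → ¬ TopeCommittee L Q)

CriticalCommittee : ∀ {m} → (SV m → Set) → (SV m → Set) → Set₁
CriticalCommittee L K = MinimalCommittee L K ×
  (∀ X T → K X → Tope L T → T ⊊⁺ X →
     ¬ TopeCommittee L (λ Y → (K Y × Y ≢ X) ⊎ Y ≡ T))

-- Adjacent topes of a simple oriented matroid differ in exactly one element, because by covector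
-- elimination a covector covered by a tope has a single zero. So each step of the symmetric cycle
-- flips one element, and since T^(k+m) = −T^k every element flips exactly once in any m consecutive
-- steps. Call a step rising if its element becomes +. The members of max⁺(V) are the peaks, the topes
-- entered by a rising and left by a falling step; equivalently, the topes that are + at the element
-- separating them from each neighbour in V. If e becomes + at step u, it is + on the next m topes and
-- − on the m after them. Rises and falls alternate, so the first of these halves has one more peak than
-- valley, and by antipodality its valleys are the peaks of the second half. Hence |max⁺(V)| = 2c + 1
-- with exactly c + 1 members positive at each e: a committee with no slack, which makes it critical.
-- It is minimal because a peak is the only member of V positive at both elements flipped next to it.

module Submission where

open import Defs
open import Data.Bool using (Bool; true; false; not; _∧_; if_then_else_)
open import Data.Bool.Properties using (not-involutive)
open import Data.Empty using (⊥; ⊥-elim)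
open import Data.Fin as Fin using (Fin; toℕ; fromℕ<; punchOut)
open import Data.Fin.Properties
  using (any?; toℕ-fromℕ<; toℕ-injective; toℕ<n; punchOut-injective; injective⇒≤)
  renaming (_≟_ to _≟ᶠ_)
open import Data.List using (List; []; _∷_; _++_; length)
open import Data.List.Membership.Propositional using (_∈_)
open import Data.List.Membership.Propositional.Properties using (∈-∃++; ∈-++⁻; ∈-++⁺ˡ; ∈-++⁺ʳ)
open import Data.List.Properties using (length-++; length-++-sucʳ)
open import Data.List.Relation.Unary.All as All using ()
open import Data.List.Relation.Unary.AllPairs using ([]; _∷_)
open import Data.List.Relation.Unary.Any using (here; there)
open import Data.List.Relation.Unary.Unique.Propositional using (Unique)
open import Data.List.Relation.Unary.Unique.Propositional.Properties using (++⁺)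
open import Data.Nat
  using ( ℕ; zero; suc; pred; _+_; _*_; _∸_; _≤_; _<_; z≤n; s≤s; z<s; _<?_; NonZero; _%_
        ; ⌈_/2⌉; ⌊_/2⌋; anyUpTo?)
open import Data.Nat.DivMod
  using ( _mod_; %-distribˡ-+; m%n%n≡m%n; [m+n]%n≡m%n; [m+kn]%n≡m%n; m%n<n; m<n⇒m%n≡m; n%n≡0
        ; m≤n⇒[n∸m]%m≡n%m)
open import Data.Nat.Induction using (<-wellFounded)
open import Data.Nat.Properties
open import Algebra.Properties.CommutativeSemigroup +-commutativeSemigroup using (x∙yz≈y∙xz; xy∙z≈xz∙y)
open import Data.Product using (∃; ∃₂; ∃-syntax; _×_; _,_; proj₁; proj₂)
open import Data.Sum using (_⊎_; inj₁; inj₂; [_,_]) renaming (map to map-⊎)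
open import Data.Vec using ([]; _∷_; lookup; tabulate)
open import Data.Vec.Properties using (lookup-map; lookup-zipWith; tabulate∘lookup; tabulate-cong; ≡-dec)
open import Function using (_∘_)
open import Function.Bundles using (_⇔_; mk⇔; Equivalence)
open import Induction.WellFounded using (Acc; acc)
open import Relation.Binary.Definitions using (DecidableEquality)
open import Relation.Binary.PropositionalEquality
  using (_≡_; _≢_; refl; sym; trans; cong; cong₂; subst; subst₂; module ≡-Reasoning)
open import Relation.Nullary using (¬_; Dec; yes; no; does; ¬?; contradiction)
open import Relation.Nullary.Decidable using (_×-dec_)

open Equivalence using (to; from)

_≟ₛ_ : DecidableEquality Sign
minus ≟ₛ minus = yes refl
zer   ≟ₛ zer   = yes refl
plus  ≟ₛ plus  = yes refl
minus ≟ₛ zer   = no λ ()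
minus ≟ₛ plus  = no λ ()
zer   ≟ₛ minus = no λ ()
zer   ≟ₛ plus  = no λ ()
plus  ≟ₛ minus = no λ ()
plus  ≟ₛ zer   = no λ ()

negS-involutive : ∀ a → negS (negS a) ≡ a
negS-involutive minus = refl
negS-involutive zer   = refl
negS-involutive plus  = refl

≡negS⇒zer : ∀ {a} → a ≡ negS a → a ≡ zer
≡negS⇒zer {zer} _ = refl

negS-≢zer : ∀ {a} → a ≢ zer → negS a ≢ zer
negS-≢zer a≢0 eq = a≢0 (trans (sym (negS-involutive _)) (cong negS eq))

compS-≢zer : ∀ {a} b → a ≢ zer → compS a b ≡ a
compS-≢zer {minus} _ _   = refl
compS-≢zer {zer}   _ a≢0 = contradiction refl a≢0
compS-≢zer {plus}  _ _   = refl

compS-idem : ∀ a → compS a a ≡ a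
compS-idem minus = refl
compS-idem zer   = refl
compS-idem plus  = refl

≢⇒≡negS : ∀ {a b} → a ≢ zer → b ≢ zer → a ≢ b → a ≡ negS b
≢⇒≡negS {minus} {plus}  _   _   _   = refl
≢⇒≡negS {plus}  {minus} _   _   _   = refl
≢⇒≡negS {minus} {minus} _   _   a≢b = contradiction refl a≢b
≢⇒≡negS {plus}  {plus}  _   _   a≢b = contradiction refl a≢b
≢⇒≡negS {zer}           a≢0 _   _   = contradiction refl a≢0
≢⇒≡negS {_}     {zer}   _   b≢0 _   = contradiction refl b≢0

≢negS⇒≡ : ∀ {a b} → a ≢ zer → b ≢ zer → a ≢ negS b → a ≡ b
≢negS⇒≡ a≢0 b≢0 a≢-b = trans (≢⇒≡negS a≢0 (negS-≢zer b≢0) a≢-b) (negS-involutive _)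

≢zer-≢plus⇒negS≡plus : ∀ {a} → a ≢ zer → a ≢ plus → negS a ≡ plus
≢zer-≢plus⇒negS≡plus {minus} _   _    = refl
≢zer-≢plus⇒negS≡plus {zer}   a≢0 _    = contradiction refl a≢0
≢zer-≢plus⇒negS≡plus {plus}  _   a≢+  = contradiction refl a≢+

isPlus : Sign → Bool
isPlus a = does (a ≟ₛ plus)

isPlus⇔ : ∀ {a} → isPlus a ≡ true ⇔ a ≡ plus
isPlus⇔ {minus} = mk⇔ (λ ()) (λ ())
isPlus⇔ {zer}   = mk⇔ (λ ()) (λ ())
isPlus⇔ {plus}  = mk⇔ (λ _ → refl) (λ _ → refl)

isPlus-negS : ∀ {a} → a ≢ zer → isPlus (negS a) ≡ not (isPlus a)
isPlus-negS {minus} _   = refl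
isPlus-negS {zer}   a≢0 = contradiction refl a≢0
isPlus-negS {plus}  _   = refl

isPlus-∧⇔ : ∀ {a b} → isPlus a ∧ isPlus b ≡ true ⇔ (a ≡ plus × b ≡ plus)
isPlus-∧⇔ {a} {b} with a ≟ₛ plus | b ≟ₛ plus
... | yes a≡+ | yes b≡+ = mk⇔ (λ _ → a≡+ , b≡+) (λ _ → refl)
... | yes _   | no b≢+  = mk⇔ (λ ()) (λ (_ , b≡+) → contradiction b≡+ b≢+)
... | no a≢+  | _       = mk⇔ (λ ()) (λ (a≡+ , _) → contradiction a≡+ a≢+)

module _ {m : ℕ} where

  lookup-∘ₛ : ∀ (X Y : SV m) e → lookup (X ∘ₛ Y) e ≡ compS (lookup X e) (lookup Y e)
  lookup-∘ₛ X Y e = lookup-zipWith compS e X Y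

  lookup-neg : ∀ (X : SV m) e → lookup (neg X) e ≡ negS (lookup X e)
  lookup-neg X e = lookup-map e negS X

  lookup-∘ₛ-≢zer : ∀ (X Y : SV m) {e} → lookup X e ≢ zer → lookup (X ∘ₛ Y) e ≡ lookup X e
  lookup-∘ₛ-≢zer X Y {e} Xe≢0 = trans (lookup-∘ₛ X Y e) (compS-≢zer _ Xe≢0)

  lookup-∘ₛ-zer : ∀ (X Y : SV m) {e} → lookup X e ≡ zer → lookup (X ∘ₛ Y) e ≡ lookup Y e
  lookup-∘ₛ-zer X Y {e} Xe≡0 = trans (lookup-∘ₛ X Y e) (cong (λ a → compS a (lookup Y e)) Xe≡0)

  lookup-extensionality : ∀ {X Y : SV m} → (∀ e → lookup X e ≡ lookup Y e) → X ≡ Y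
  lookup-extensionality {X} {Y} X≗Y = begin
    X                    ≡⟨ tabulate∘lookup X ⟨
    tabulate (lookup X)  ≡⟨ tabulate-cong X≗Y ⟩
    tabulate (lookup Y)  ≡⟨ tabulate∘lookup Y ⟩
    Y                    ∎
    where open ≡-Reasoning

  neg-involutive : ∀ (X : SV m) → neg (neg X) ≡ X
  neg-involutive X = lookup-extensionality λ e →
    trans (lookup-neg (neg X) e) (trans (cong negS (lookup-neg X e)) (negS-involutive _))

  Sep? : ∀ (X Y : SV m) e → Dec (Sep X Y e)
  Sep? X Y e = (lookup X e ≟ₛ negS (lookup Y e)) ×-dec ¬? (lookup X e ≟ₛ zer)

  Sep-sym : ∀ {X Y : SV m} {e} → Sep X Y e → Sep Y X e
  Sep-sym (Xe≡-Ye , Xe≢0) =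
    sym (trans (cong negS Xe≡-Ye) (negS-involutive _)) , λ Ye≡0 → Xe≢0 (trans Xe≡-Ye (cong negS Ye≡0))

  Sep-neg : ∀ {X Y : SV m} {e} → Sep (neg X) (neg Y) e → Sep X Y e
  Sep-neg {X} {Y} {e} (-Xe≡-[-Ye] , -Xe≢0) = Xe≡-Ye , λ Xe≡0 → -Xe≢0 (trans (lookup-neg X e) (cong negS Xe≡0))
    where
    open ≡-Reasoning
    Xe≡-Ye : lookup X e ≡ negS (lookup Y e)
    Xe≡-Ye = begin
      lookup X e                          ≡⟨ negS-involutive _ ⟨
      negS (negS (lookup X e))            ≡⟨ cong negS (lookup-neg X e) ⟨
      negS (lookup (neg X) e)             ≡⟨ cong negS -Xe≡-[-Ye] ⟩
      negS (negS (lookup (neg Y) e))      ≡⟨ negS-involutive _ ⟩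
      lookup (neg Y) e                    ≡⟨ lookup-neg Y e ⟩
      negS (lookup Y e)                   ∎

  ≡⇒¬Sep : ∀ {X Y : SV m} {e} → lookup X e ≡ lookup Y e → ¬ Sep X Y e
  ≡⇒¬Sep Xe≡Ye (Xe≡-Ye , Xe≢0) = Xe≢0 (≡negS⇒zer (trans Xe≡-Ye (cong negS (sym Xe≡Ye))))

  ¬Sep⇒zer⊎≡ : ∀ {X Y : SV m} {e} → lookup Y e ≢ zer → ¬ Sep X Y e →
               lookup X e ≡ zer ⊎ lookup X e ≡ lookup Y e
  ¬Sep⇒zer⊎≡ {X} {Y} {e} Ye≢0 ¬sep with lookup X e ≟ₛ zer
  ... | yes Xe≡0 = inj₁ Xe≡0
  ... | no Xe≢0  = inj₂ (≢negS⇒≡ Xe≢0 Ye≢0 λ Xe≡-Ye → ¬sep (Xe≡-Ye , Xe≢0))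

  ≼-∘ₛ : ∀ (X Y : SV m) → X ≼ (X ∘ₛ Y)
  ≼-∘ₛ X Y e with lookup X e ≟ₛ zer
  ... | yes Xe≡0 = inj₁ Xe≡0
  ... | no Xe≢0  = inj₂ (sym (lookup-∘ₛ-≢zer X Y Xe≢0))

  ≼-≢zer : ∀ {X Y : SV m} {e} → X ≼ Y → lookup X e ≢ zer → lookup Y e ≡ lookup X e
  ≼-≢zer {e = e} X≼Y Xe≢0 with X≼Y e
  ... | inj₁ Xe≡0  = contradiction Xe≡0 Xe≢0
  ... | inj₂ Xe≡Ye = sym Xe≡Ye

  Sep-above⇒zer : ∀ {X A B : SV m} {e} → X ≼ A → X ≼ B → Sep A B e → lookup X e ≡ zer
  Sep-above⇒zer {X} {A} {B} {e} X≼A X≼B sep with lookup X e ≟ₛ zer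
  ... | yes Xe≡0 = Xe≡0
  ... | no Xe≢0  = contradiction sep
    (≡⇒¬Sep {A} {B} (trans (≼-≢zer {X} {A} X≼A Xe≢0) (sym (≼-≢zer {X} {B} X≼B Xe≢0))))

  ⊊⁺-of-single-separator : ∀ {X S : SV m} {e} → (∀ g → lookup X g ≢ zer) → (∀ g → lookup S g ≢ zer) →
                           (∀ f → Sep S X f ⇔ f ≡ e) → lookup X e ≢ plus → X ⊊⁺ S
  ⊊⁺-of-single-separator {X} {S} {e} X-full S-full separators Xe≢+ = X⁺⊆S⁺ , e , Se≡+ , Xe≢+
    where
    Se≡+ : lookup S e ≡ plus
    Se≡+ = trans (proj₁ (from (separators e) refl)) (≢zer-≢plus⇒negS≡plus (X-full e) Xe≢+)
    X⁺⊆S⁺ : X ⊆⁺ S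
    X⁺⊆S⁺ g Xg≡+ with g ≟ᶠ e | ¬Sep⇒zer⊎≡ {S} {X} {g} (X-full g)
    ... | yes refl | _    = contradiction Xg≡+ Xe≢+
    ... | no g≢e   | same with same (g≢e ∘ to (separators g))
    ...   | inj₁ Sg≡0  = contradiction Sg≡0 (S-full g)
    ...   | inj₂ Sg≡Xg = trans Sg≡Xg Xg≡+

disagreements : ∀ {m} → SV m → SV m → ℕ
disagreements []      []      = 0
disagreements (a ∷ X) (b ∷ Y) = (if does (a ≟ₛ b) then 0 else 1) + disagreements X Y

disagreements-mono : ∀ {m} (Y Z T : SV m) → (∀ e → lookup Y e ≡ lookup T e → lookup Z e ≡ lookup T e) →
                     disagreements Z T ≤ disagreements Y T
disagreements-mono []      []      []      _     = z≤n
disagreements-mono (y ∷ Y) (z ∷ Z) (t ∷ T) agree with y ≟ₛ t | z ≟ₛ t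
... | yes _   | yes _   = disagreements-mono Y Z T (agree ∘ Fin.suc)
... | yes y≡t | no z≢t  = contradiction (agree Fin.zero y≡t) z≢t
... | no _    | yes _   = m≤n⇒m≤1+n (disagreements-mono Y Z T (agree ∘ Fin.suc))
... | no _    | no _    = s≤s (disagreements-mono Y Z T (agree ∘ Fin.suc))

disagreements-< : ∀ {m} (Y Z T : SV m) f → (∀ e → lookup Y e ≡ lookup T e → lookup Z e ≡ lookup T e) →
                  lookup Z f ≡ lookup T f → lookup Y f ≢ lookup T f → disagreements Z T < disagreements Y T
disagreements-< (y ∷ Y) (z ∷ Z) (t ∷ T) Fin.zero agree z≡t y≢t with y ≟ₛ t | z ≟ₛ t
... | yes y≡t | _      = contradiction y≡t y≢t
... | no _    | yes _  = s≤s (disagreements-mono Y Z T (agree ∘ Fin.suc))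
... | no _    | no z≢t = contradiction z≡t z≢t
disagreements-< (y ∷ Y) (z ∷ Z) (t ∷ T) (Fin.suc f) agree zf yf with y ≟ₛ t | z ≟ₛ t
... | yes _   | yes _  = disagreements-< Y Z T f (agree ∘ Fin.suc) zf yf
... | yes y≡t | no z≢t = contradiction (agree Fin.zero y≡t) z≢t
... | no _    | yes _  = m≤n⇒m≤1+n (disagreements-< Y Z T f (agree ∘ Fin.suc) zf yf)
... | no _    | no _   = s≤s (disagreements-< Y Z T f (agree ∘ Fin.suc) zf yf)

surjective⇒injective : ∀ {n} (g : Fin n → Fin n) → (∀ y → ∃ λ x → g x ≡ y) →
                       ∀ {i j} → g i ≡ g j → i ≡ j
surjective⇒injective {suc n} g surjective {i} {j} gi≡gj with i ≟ᶠ j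
... | yes i≡j = i≡j
... | no i≢j  = contradiction (injective⇒≤ section-injective) 1+n≰n
  where
  preimage : ∀ y → ∃ λ x → g x ≡ y × x ≢ j
  preimage y with surjective y
  ... | x , gx≡y with x ≟ᶠ j
  ...   | yes refl = i , trans gi≡gj gx≡y , i≢j
  ...   | no x≢j   = x , gx≡y , x≢j
  section : Fin (suc n) → Fin n
  section y = punchOut (proj₂ (proj₂ (preimage y)) ∘ sym)
  section-injective : ∀ {y y'} → section y ≡ section y' → y ≡ y'
  section-injective {y} {y'} eq = begin
    y                          ≡⟨ proj₁ (proj₂ (preimage y)) ⟨
    g (proj₁ (preimage y))     ≡⟨ cong g (punchOut-injective {i = j} _ _ eq) ⟩
    g (proj₁ (preimage y'))    ≡⟨ proj₁ (proj₂ (preimage y')) ⟩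
    y'                         ∎
    where open ≡-Reasoning

lower-or-upper-half : ∀ {m j} → j < m + m → j < m ⊎ ∃ λ j' → j' < m × j ≡ j' + m
lower-or-upper-half {m} {j} j<m+m with j <? m
... | yes j<m = inj₁ j<m
... | no j≮m  = inj₂ (j ∸ m , +-cancelʳ-< m (j ∸ m) m (subst (_< m + m) (sym j∸m+m≡j) j<m+m) , sym j∸m+m≡j)
  where
  j∸m+m≡j : j ∸ m + m ≡ j
  j∸m+m≡j = m∸n+n≡m (≮⇒≥ j≮m)

[m+n%d]%d≡[m+n]%d : ∀ m n d .{{_ : NonZero d}} → (m + n % d) % d ≡ (m + n) % d
[m+n%d]%d≡[m+n]%d m n d = begin
  (m + n % d) % d            ≡⟨ %-distribˡ-+ m (n % d) d ⟩
  (m % d + n % d % d) % d    ≡⟨ cong (λ x → (m % d + x) % d) (m%n%n≡m%n n d) ⟩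
  (m % d + n % d) % d        ≡⟨ %-distribˡ-+ m n d ⟨
  (m + n) % d                ∎
  where open ≡-Reasoning

[m%d+n]%d≡[m+n]%d : ∀ m n d .{{_ : NonZero d}} → (m % d + n) % d ≡ (m + n) % d
[m%d+n]%d≡[m+n]%d m n d = begin
  (m % d + n) % d   ≡⟨ cong (_% d) (+-comm (m % d) n) ⟩
  (n + m % d) % d   ≡⟨ [m+n%d]%d≡[m+n]%d n m d ⟩
  (n + m) % d       ≡⟨ cong (_% d) (+-comm n m) ⟩
  (m + n) % d       ∎
  where open ≡-Reasoning

+-%-congˡ : ∀ c {a b} d .{{_ : NonZero d}} → a % d ≡ b % d → (c + a) % d ≡ (c + b) % d
+-%-congˡ c {a} {b} d a≡b = begin
  (c + a) % d       ≡⟨ [m+n%d]%d≡[m+n]%d c a d ⟨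
  (c + a % d) % d   ≡⟨ cong (λ x → (c + x) % d) a≡b ⟩
  (c + b % d) % d   ≡⟨ [m+n%d]%d≡[m+n]%d c b d ⟩
  (c + b) % d       ∎
  where open ≡-Reasoning

+-%-surjective : ∀ a n d .{{_ : NonZero d}} → ∃ λ j → j < d × (a + j) % d ≡ n % d
+-%-surjective a n d = N % d , m%n<n N d , (begin
  (a + N % d) % d   ≡⟨ [m+n%d]%d≡[m+n]%d a N d ⟩
  (a + N) % d       ≡⟨ cong (_% d) a+N≡n+a*d ⟩
  (n + a * d) % d   ≡⟨ [m+kn]%n≡m%n n a d ⟩
  n % d             ∎)
  where
  open ≡-Reasoning
  N : ℕ
  N = n + a * pred d
  a+N≡n+a*d : a + N ≡ n + a * d
  a+N≡n+a*d = begin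
    a + (n + a * pred d)   ≡⟨ x∙yz≈y∙xz a n _ ⟩
    n + (a + a * pred d)   ≡⟨ cong (n +_) (*-suc a (pred d)) ⟨
    n + a * suc (pred d)   ≡⟨ cong (λ x → n + a * x) (suc-pred d) ⟩
    n + a * d              ∎

[m+n]%d≢m%d : ∀ b k d .{{_ : NonZero d}} → 0 < k → k < d → (b + k) % d ≢ b % d
[m+n]%d≢m%d b k d 0<k k<d eq with b % d + k <? d
... | yes r+k<d = <⇒≢ 0<k (sym (+-cancelˡ-≡ r k 0 (trans (sym r+k%d≡r+k) (trans r+k%d≡r (sym (+-identityʳ r))))))
  where
  r : ℕ
  r = b % d
  r+k%d≡r : (r + k) % d ≡ r
  r+k%d≡r = trans ([m%d+n]%d≡[m+n]%d b k d) eq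
  r+k%d≡r+k : (r + k) % d ≡ r + k
  r+k%d≡r+k = m<n⇒m%n≡m r+k<d
... | no r+k≮d = <⇒≢ k<d (+-cancelˡ-≡ r k d (begin
    r + k            ≡⟨ m∸n+n≡m d≤r+k ⟨
    r + k ∸ d + d    ≡⟨ cong (_+ d) r+k∸d≡r ⟩
    r + d            ∎))
  where
  open ≡-Reasoning
  r : ℕ
  r = b % d
  d≤r+k : d ≤ r + k
  d≤r+k = ≮⇒≥ r+k≮d
  r+k∸d<d : r + k ∸ d < d
  r+k∸d<d = +-cancelʳ-< d (r + k ∸ d) d (subst (_< d + d) (sym (m∸n+n≡m d≤r+k)) (+-mono-< (m%n<n b d) k<d))
  r+k∸d≡r : r + k ∸ d ≡ r
  r+k∸d≡r = begin
    r + k ∸ d              ≡⟨ m<n⇒m%n≡m r+k∸d<d ⟨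
    (r + k ∸ d) % d        ≡⟨ m≤n⇒[n∸m]%m≡n%m d≤r+k ⟩
    (r + k) % d            ≡⟨ [m%d+n]%d≡[m+n]%d b k d ⟩
    (b + k) % d            ≡⟨ eq ⟩
    r                      ∎

[m+i]%d≢[m+j]%d : ∀ a {i j} d .{{_ : NonZero d}} → i < j → j < d → (a + i) % d ≢ (a + j) % d
[m+i]%d≢[m+j]%d a {i} {j} d i<j j<d eq =
  [m+n]%d≢m%d (a + i) (j ∸ i) d (m<n⇒0<n∸m i<j) (≤-<-trans (m∸n≤m j i) j<d)
    (trans (cong (_% d) a+i+[j∸i]≡a+j) (sym eq))
  where
  a+i+[j∸i]≡a+j : a + i + (j ∸ i) ≡ a + j
  a+i+[j∸i]≡a+j = trans (+-assoc a i (j ∸ i)) (cong (a +_) (m+[n∸m]≡n (<⇒≤ i<j)))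

-- Counting

module _ {A : Set} where

  Unique⇒length-≤ : ∀ {xs ys : List A} → Unique xs → (∀ {x} → x ∈ xs → x ∈ ys) →
                    length xs ≤ length ys
  Unique⇒length-≤ {[]}     _            _    = z≤n
  Unique⇒length-≤ {x ∷ xs} {ys} (x∉xs ∷ xs!) xs⊆ys with ∈-∃++ (xs⊆ys (here refl))
  ... | ys₁ , ys₂ , refl = begin
    suc (length xs)                ≤⟨ s≤s (Unique⇒length-≤ xs! xs⊆ys₁++ys₂) ⟩
    suc (length (ys₁ ++ ys₂))      ≡⟨ length-++-sucʳ ys₁ x ys₂ ⟨
    length (ys₁ ++ x ∷ ys₂)        ∎
    where
    open ≤-Reasoning
    xs⊆ys₁++ys₂ : ∀ {y} → y ∈ xs → y ∈ ys₁ ++ ys₂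
    xs⊆ys₁++ys₂ y∈xs with ∈-++⁻ ys₁ (xs⊆ys (there y∈xs))
    ... | inj₁ y∈ys₁         = ∈-++⁺ˡ y∈ys₁
    ... | inj₂ (here refl)   = contradiction refl (All.lookup x∉xs y∈xs)
    ... | inj₂ (there y∈ys₂) = ∈-++⁺ʳ ys₁ y∈ys₂

  ∈-if-∷ : ∀ b {x y : A} {xs} → x ∈ xs → x ∈ (if b then y ∷ xs else xs)
  ∈-if-∷ true  = there
  ∈-if-∷ false x∈xs = x∈xs

bit : Bool → ℕ
bit false = 0
bit true  = 1

count : (ℕ → Bool) → ℕ → ℕ → ℕ
count P a zero    = 0
count P a (suc L) = bit (P a) + count P (suc a) L

count-++ : ∀ P a L₁ L₂ → count P a (L₁ + L₂) ≡ count P a L₁ + count P (a + L₁) L₂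
count-++ P a zero     L₂ = cong (λ b → count P b L₂) (sym (+-identityʳ a))
count-++ P a (suc L₁) L₂ = begin
  b + count P (suc a) (L₁ + L₂)                          ≡⟨ cong (b +_) (count-++ P (suc a) L₁ L₂) ⟩
  b + (count P (suc a) L₁ + count P (suc a + L₁) L₂)     ≡⟨ +-assoc b _ _ ⟨
  b + count P (suc a) L₁ + count P (suc (a + L₁)) L₂
    ≡⟨ cong (λ n → b + count P (suc a) L₁ + count P n L₂) (+-suc a L₁) ⟨
  b + count P (suc a) L₁ + count P (a + suc L₁) L₂       ∎
  where
  open ≡-Reasoning
  b : ℕ
  b = bit (P a)

count-cong : ∀ P Q a b L → (∀ i → i < L → P (a + i) ≡ Q (b + i)) → count P a L ≡ count Q b L
count-cong P Q a b zero    _   = refl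
count-cong P Q a b (suc L) P≗Q = cong₂ _+_
  (cong bit (subst₂ (λ x y → P x ≡ Q y) (+-identityʳ a) (+-identityʳ b) (P≗Q 0 z<s)))
  (count-cong P Q (suc a) (suc b) L λ i i<L →
    subst₂ (λ x y → P x ≡ Q y) (+-suc a i) (+-suc b i) (P≗Q (suc i) (s≤s i<L)))

peakOf : (ℕ → Bool) → ℕ → Bool
peakOf r n = r n ∧ not (r (suc n))

valleyOf : (ℕ → Bool) → ℕ → Bool
valleyOf r n = not (r n) ∧ r (suc n)

bit-peak+bit≡bit-valley+bit : ∀ x y → bit (x ∧ not y) + bit y ≡ bit (not x ∧ y) + bit x
bit-peak+bit≡bit-valley+bit true  true  = refl
bit-peak+bit≡bit-valley+bit true  false = refl
bit-peak+bit≡bit-valley+bit false true  = refl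
bit-peak+bit≡bit-valley+bit false false = refl

peaks-balance : ∀ r a L → count (peakOf r) a L + bit (r (a + L)) ≡ count (valleyOf r) a L + bit (r a)
peaks-balance r a zero    = cong (bit ∘ r) (+-identityʳ a)
peaks-balance r a (suc L) = begin
  p + peaks + bit (r (a + suc L))     ≡⟨ cong (λ n → p + peaks + bit (r n)) (+-suc a L) ⟩
  p + peaks + bit (r (suc a + L))     ≡⟨ +-assoc p peaks _ ⟩
  p + (peaks + bit (r (suc a + L)))   ≡⟨ cong (p +_) (peaks-balance r (suc a) L) ⟩
  p + (valleys + bit (r (suc a)))     ≡⟨ x∙yz≈y∙xz p valleys _ ⟩
  valleys + (p + bit (r (suc a)))     ≡⟨ cong (valleys +_) (bit-peak+bit≡bit-valley+bit (r a) (r (suc a))) ⟩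
  valleys + (v + bit (r a))           ≡⟨ x∙yz≈y∙xz valleys v _ ⟩
  v + (valleys + bit (r a))           ≡⟨ +-assoc v valleys _ ⟨
  v + valleys + bit (r a)             ∎
  where
  open ≡-Reasoning
  p : ℕ
  p = bit (peakOf r a)
  v : ℕ
  v = bit (valleyOf r a)
  peaks : ℕ
  peaks = count (peakOf r) (suc a) L
  valleys : ℕ
  valleys = count (valleyOf r) (suc a) L

module _ {A : Set} (P : ℕ → Bool) (f : ℕ → A) where

  select : ℕ → ℕ → List A
  select a zero    = []
  select a (suc L) = if P a then f a ∷ select (suc a) L else select (suc a) L

  length-select : ∀ a L → length (select a L) ≡ count P a L
  length-select a zero = refl
  length-select a (suc L) with P a
  ... | true  = cong suc (length-select (suc a) L)
  ... | false = length-select (suc a) L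

  private
    shift : ∀ {a L x} → (∃ λ i → i < L × P (suc a + i) ≡ true × f (suc a + i) ≡ x) →
            ∃ λ i → i < suc L × P (a + i) ≡ true × f (a + i) ≡ x
    shift {a} (i , i<L , Pi , fi≡x) = suc i , s≤s i<L , trans (cong P (+-suc a i)) Pi , trans (cong f (+-suc a i)) fi≡x

  ∈-select⁻ : ∀ a L {x} → x ∈ select a L → ∃ λ i → i < L × P (a + i) ≡ true × f (a + i) ≡ x
  ∈-select⁻ a (suc L) x∈ with P a in Pa
  ∈-select⁻ a (suc L) (here x≡fa) | true =
    0 , z<s , trans (cong P (+-identityʳ a)) Pa , trans (cong f (+-identityʳ a)) (sym x≡fa)
  ∈-select⁻ a (suc L) (there x∈) | true  = shift (∈-select⁻ (suc a) L x∈)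
  ∈-select⁻ a (suc L) x∈         | false = shift (∈-select⁻ (suc a) L x∈)

  ∈-select⁺ : ∀ a L i → i < L → P (a + i) ≡ true → f (a + i) ∈ select a L
  ∈-select⁺ a (suc L) zero _ P[a+0] with P a in Pa
  ... | true  = here (cong f (+-identityʳ a))
  ... | false = contradiction (trans (sym Pa) (trans (cong P (sym (+-identityʳ a))) P[a+0])) λ ()
  ∈-select⁺ a (suc L) (suc i) (s≤s i<L) P[a+1+i] = ∈-if-∷ (P a)
    (subst (_∈ select (suc a) L) (cong f (sym (+-suc a i)))
      (∈-select⁺ (suc a) L i i<L (trans (cong P (sym (+-suc a i))) P[a+1+i])))

  select-unique : ∀ a L → (∀ {i j} → i < j → j < L → f (a + i) ≢ f (a + j)) → Unique (select a L)
  select-unique a zero    _ = []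
  select-unique a (suc L) f-inj with P a | select-unique (suc a) L (λ {i} {j} i<j j<L eq →
    f-inj (s≤s i<j) (s≤s j<L) (trans (cong f (+-suc a i)) (trans eq (cong f (sym (+-suc a j))))))
  ... | false | rest! = rest!
  ... | true  | rest! = All.tabulate fresh ∷ rest!
    where
    fresh : ∀ {x} → x ∈ select (suc a) L → f a ≢ x
    fresh x∈ fa≡x with ∈-select⁻ (suc a) L x∈
    ... | i , i<L , _ , fi≡x =
      f-inj z<s (s≤s i<L) (trans (cong f (+-identityʳ a)) (trans fa≡x (trans (sym fi≡x) (cong f (sym (+-suc a i))))))

module _ {m : ℕ} {P Q : SV m → Set} where

  HasSize-mono : ∀ {a b} → HasSize P a → HasSize Q b → (∀ x → P x → Q x) → a ≤ b
  HasSize-mono (xs , xs! , refl , xs⇔P) (ys , _ , refl , ys⇔Q) P⊆Q =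
    Unique⇒length-≤ xs! λ {x} x∈xs → from (ys⇔Q x) (P⊆Q x (to (xs⇔P x) x∈xs))

  HasSize-⊎ : ∀ {a b} → HasSize P a → HasSize Q b → (∀ x → P x → ¬ Q x) →
              HasSize (λ x → P x ⊎ Q x) (a + b)
  HasSize-⊎ (xs , xs! , refl , xs⇔P) (ys , ys! , refl , ys⇔Q) disjoint =
    xs ++ ys ,
    ++⁺ xs! ys! (λ (x∈xs , x∈ys) → disjoint _ (to (xs⇔P _) x∈xs) (to (ys⇔Q _) x∈ys)) ,
    length-++ xs ,
    λ x → mk⇔ (map-⊎ (to (xs⇔P x)) (to (ys⇔Q x)) ∘ ∈-++⁻ xs)
              [ ∈-++⁺ˡ ∘ from (xs⇔P x) , ∈-++⁺ʳ xs ∘ from (ys⇔Q x) ]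

HasSize-unique : ∀ {m} {P : SV m → Set} {a b} → HasSize P a → HasSize P b → a ≡ b
HasSize-unique Pa Pb = ≤-antisym (HasSize-mono Pa Pb λ _ p → p) (HasSize-mono Pb Pa λ _ p → p)

HasSize-≡ : ∀ {m} (z : SV m) → HasSize (_≡ z) 1
HasSize-≡ z = z ∷ [] , All.[] ∷ [] , refl , λ x → mk⇔ (λ { (here x≡z) → x≡z ; (there ()) }) here

-- Committees

suc[c+c]<2*suc[c] : ∀ c → suc (c + c) < 2 * suc c
suc[c+c]<2*suc[c] c = ≤-reflexive (cong suc (sym (trans (cong (c +_) (+-identityʳ (suc c))) (+-suc c c))))

¬two-majorities : ∀ {q a b} → q < 2 * a → q < 2 * b → a + b ≤ q → ⊥
¬two-majorities {q} {a} {b} q<2a q<2b a+b≤q = <-irrefl refl (begin-strict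
  q + q           <⟨ +-mono-< q<2a q<2b ⟩
  2 * a + 2 * b   ≡⟨ *-distribˡ-+ 2 a b ⟨
  2 * (a + b)     ≤⟨ *-monoʳ-≤ 2 a+b≤q ⟩
  2 * q           ≡⟨ cong (q +_) (+-identityʳ q) ⟩
  q + q           ∎)
  where open ≤-Reasoning

¬majority-within-half : ∀ {c q k} → c + c ≤ q → k ≤ c → q < 2 * k → ⊥
¬majority-within-half {c} {q} {k} c+c≤q k≤c q<2k = <-irrefl refl (begin-strict
  q       <⟨ q<2k ⟩
  2 * k   ≤⟨ *-monoʳ-≤ 2 k≤c ⟩
  2 * c   ≡⟨ cong (c +_) (+-identityʳ c) ⟩
  c + c   ≤⟨ c+c≤q ⟩
  q       ∎)
  where open ≤-Reasoning

module _ {m : ℕ} {L K : SV m → Set} where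

  odd-majority⇒committee : ∀ {c} → (∀ X → K X → Tope L X) → HasSize K (suc (c + c)) →
                           (∀ e → HasSize (λ X → K X × lookup X e ≡ plus) (suc c)) → TopeCommittee L K
  odd-majority⇒committee {c} K-topes K-size Kₑ-size =
    K-topes , suc (c + c) , K-size , λ e → suc c , Kₑ-size e , suc[c+c]<2*suc[c] c

  unique-on-pair⇒minimal : (∀ X → K X → ∃₂ λ e f →
                              ∀ Y → K Y → lookup Y e ≡ plus → lookup Y f ≡ plus → Y ≡ X) →
                           ∀ Q → Q ⊂ₚ K → ¬ TopeCommittee L Q
  unique-on-pair⇒minimal pair Q (Q⊆K , X , KX , X∉Q) (_ , q , Q-size , majority) with pair X KX
  ... | e , f , only-X with majority e | majority f
  ...   | kₑ , Qₑ-size , q<2kₑ | k_f , Q_f-size , q<2k_f =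
    ¬two-majorities {q} {kₑ} {k_f} q<2kₑ q<2k_f
      (HasSize-mono (HasSize-⊎ Qₑ-size Q_f-size disjoint) Q-size λ _ → [ proj₁ , proj₁ ])
    where
    disjoint : ∀ Y → Q Y × lookup Y e ≡ plus → ¬ (Q Y × lookup Y f ≡ plus)
    disjoint Y (QY , Ye≡+) (_ , Yf≡+) = X∉Q (subst Q (only-X Y (Q⊆K Y QY) Ye≡+ Yf≡+) QY)

  tight-majority⇒critical : ∀ {c} → HasSize K (suc (c + c)) →
                            (∀ e → HasSize (λ X → K X × lookup X e ≡ plus) (suc c)) →
                            ∀ X T → K X → T ⊊⁺ X → ¬ TopeCommittee L (λ Y → (K Y × Y ≢ X) ⊎ Y ≡ T)
  tight-majority⇒critical {c} K-size Kₑ-size X T KX (_ , e , Xe≡+ , Te≢+) (_ , q , Q-size , majority)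
    with majority e
  ... | k , Qₑ-size , q<2k = ¬majority-within-half c+c≤q k≤c q<2k
    where
    Q : SV m → Set
    Q Y = (K Y × Y ≢ X) ⊎ Y ≡ T
    X∉Q : ∀ Y → Q Y → ¬ Y ≡ X
    X∉Q Y (inj₁ (_ , Y≢X)) Y≡X = Y≢X Y≡X
    X∉Q Y (inj₂ refl)      refl = Te≢+ Xe≡+
    K⊆Q+X : ∀ Y → K Y → Q Y ⊎ Y ≡ X
    K⊆Q+X Y KY with ≡-dec _≟ₛ_ Y X
    ... | yes Y≡X = inj₂ Y≡X
    ... | no Y≢X  = inj₁ (inj₁ (KY , Y≢X))
    Qₑ+X⊆Kₑ : ∀ Y → (Q Y × lookup Y e ≡ plus) ⊎ Y ≡ X → K Y × lookup Y e ≡ plus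
    Qₑ+X⊆Kₑ Y (inj₁ (inj₁ (KY , _) , Ye≡+)) = KY , Ye≡+
    Qₑ+X⊆Kₑ Y (inj₁ (inj₂ refl , Te≡+))     = contradiction Te≡+ Te≢+
    Qₑ+X⊆Kₑ Y (inj₂ refl)                   = KX , Xe≡+
    c+c≤q : c + c ≤ q
    c+c≤q = ≤-pred (subst (suc (c + c) ≤_) (+-comm q 1)
      (HasSize-mono K-size (HasSize-⊎ Q-size (HasSize-≡ X) X∉Q) K⊆Q+X))
    k≤c : k ≤ c
    k≤c = ≤-pred (subst (_≤ suc c) (+-comm k 1)
      (HasSize-mono (HasSize-⊎ Qₑ-size (HasSize-≡ X) λ Y → X∉Q Y ∘ proj₁) (Kₑ-size e) Qₑ+X⊆Kₑ))

-- Topes of a simple oriented matroid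

module _ {m : ℕ} {L : SV m → Set} (om : IsOrientedMatroid L) where
  open IsOrientedMatroid om

  tope-nonzero : (∀ e → ∃[ Y ] (L Y × lookup Y e ≢ zer)) → ∀ {X} → Tope L X → ∀ e → lookup X e ≢ zer
  tope-nonzero loopless {X} (LX , maximal) e Xe≡0 with loopless e
  ... | Y , LY , Ye≢0 = maximal (X ∘ₛ Y) (L2 X Y LX LY) (X⊆XY , e , Xe≡0 , XYe≢0)
    where
    X⊆XY : X ⊆supp (X ∘ₛ Y)
    X⊆XY f Xf≢0 XYf≡0 = Xf≢0 (trans (sym (lookup-∘ₛ-≢zer X Y Xf≢0)) XYf≡0)
    XYe≢0 : lookup (X ∘ₛ Y) e ≢ zer
    XYe≢0 XYe≡0 = Ye≢0 (trans (sym (lookup-∘ₛ-zer X Y Xe≡0)) XYe≡0)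

  elimination-above : ∀ {X A B} s → L A → L B → Sep A B s → X ≼ A → X ≼ B →
                      ∃[ Z ] (L Z × lookup Z s ≡ zer ×
                              (∀ f → ¬ Sep A B f → lookup Z f ≡ lookup (A ∘ₛ B) f) × X ≼ Z)
  elimination-above {X} {A} {B} s LA LB sep X≼A X≼B with L3 A B s LA LB sep
  ... | Z , LZ , Zs≡0 , Z-agrees = Z , LZ , Zs≡0 , Z-agrees , X≼Z
    where
    X≼Z : X ≼ Z
    X≼Z e with lookup X e ≟ₛ zer
    ... | yes Xe≡0 = inj₁ Xe≡0
    ... | no Xe≢0  = inj₂ (sym (begin
      lookup Z e          ≡⟨ Z-agrees e (≡⇒¬Sep {X = A} {Y = B} (trans Ae≡Xe (sym Be≡Xe))) ⟩
      lookup (A ∘ₛ B) e   ≡⟨ lookup-∘ₛ-≢zer A B (Xe≢0 ∘ trans (sym Ae≡Xe)) ⟩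
      lookup A e          ≡⟨ Ae≡Xe ⟩
      lookup X e          ∎))
      where
      open ≡-Reasoning
      Ae≡Xe : lookup A e ≡ lookup X e
      Ae≡Xe = ≼-≢zer {X = X} {Y = A} X≼A Xe≢0
      Be≡Xe : lookup B e ≡ lookup X e
      Be≡Xe = ≼-≢zer {X = X} {Y = B} X≼B Xe≢0

  module Covering (simple : Simple L) {X T : SV m} (LX : L X) (tope-T : Tope L T) (X⋖T : Covers L X T) where

    private
      T-full : ∀ e → lookup T e ≢ zer
      T-full = tope-nonzero (proj₁ simple) tope-T
      X≼T : X ≼ T
      X≼T = proj₁ (proj₁ X⋖T)

    -- Eliminating Y against T at a separating element gives a covector strictly closer to T
    -- that again vanishes at exactly one of two zeros of X; once nothing separates Y from T,
    -- the chain X ≺ Y ≺ T contradicts the covering.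
    no-partial-vanishing : ∀ Y {f g} → L Y → X ≼ Y → lookup X f ≡ zer → lookup X g ≡ zer →
                           lookup Y f ≡ zer → lookup Y g ≢ zer → ⊥
    no-partial-vanishing Y = go Y (<-wellFounded (disagreements Y T))
      where
      go : ∀ Y {f g} → Acc _<_ (disagreements Y T) → L Y → X ≼ Y → lookup X f ≡ zer → lookup X g ≡ zer →
           lookup Y f ≡ zer → lookup Y g ≢ zer → ⊥
      go Y {f} {g} (acc closer) LY X≼Y Xf≡0 Xg≡0 Yf≡0 Yg≢0 with any? (Sep? Y T)
      ... | no ¬sep = proj₂ X⋖T Y LY (X≼Y , X≢Y) (Y≼T , Y≢T)
        where
        X≢Y : X ≢ Y
        X≢Y refl = Yg≢0 Xg≡0
        Y≼T : Y ≼ T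
        Y≼T e = ¬Sep⇒zer⊎≡ {X = Y} {Y = T} (T-full e) (¬sep ∘ (e ,_))
        Y≢T : Y ≢ T
        Y≢T refl = T-full f Yf≡0
      ... | yes (s , sep) with elimination-above {X} s LY (proj₁ tope-T) sep X≼Y X≼T
      ...   | Z , LZ , Zs≡0 , Z-agrees , X≼Z =
        go Z (closer Z-closer) LZ X≼Z (Sep-above⇒zer {X = X} {A = Y} {B = T} X≼Y X≼T sep) Xf≡0 Zs≡0
           (T-full f ∘ trans (sym Zf≡Tf))
        where
        Zf≡Tf : lookup Z f ≡ lookup T f
        Zf≡Tf = trans (Z-agrees f λ sep → proj₂ sep Yf≡0) (lookup-∘ₛ-zer Y T Yf≡0)
        Z-agrees-where-Y-does : ∀ e → lookup Y e ≡ lookup T e → lookup Z e ≡ lookup T e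
        Z-agrees-where-Y-does e Ye≡Te = begin
          lookup Z e                            ≡⟨ Z-agrees e (≡⇒¬Sep {X = Y} {Y = T} Ye≡Te) ⟩
          lookup (Y ∘ₛ T) e                     ≡⟨ lookup-∘ₛ Y T e ⟩
          compS (lookup Y e) (lookup T e)       ≡⟨ cong (λ a → compS a (lookup T e)) Ye≡Te ⟩
          compS (lookup T e) (lookup T e)       ≡⟨ compS-idem _ ⟩
          lookup T e                            ∎
          where open ≡-Reasoning
        Z-closer : disagreements Z T < disagreements Y T
        Z-closer = disagreements-< Y Z T f Z-agrees-where-Y-does Zf≡Tf λ Yf≡Tf → T-full f (trans (sym Yf≡Tf) Yf≡0)

    vanish-together : ∀ W {e f} → L W → lookup X e ≡ zer → lookup X f ≡ zer →
                      lookup W e ≡ zer → lookup W f ≡ zer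
    vanish-together W {e} {f} LW Xe≡0 Xf≡0 We≡0 with lookup W f ≟ₛ zer
    ... | yes Wf≡0 = Wf≡0
    ... | no Wf≢0  = ⊥-elim (no-partial-vanishing (X ∘ₛ W) (L2 X W LX LW) (≼-∘ₛ X W) Xe≡0 Xf≡0
                       (trans (lookup-∘ₛ-zer X W Xe≡0) We≡0) (Wf≢0 ∘ trans (sym (lookup-∘ₛ-zer X W Xf≡0))))

    no-agreeing-and-opposite : ∀ A B {e f} → L A → L B → lookup X e ≡ zer → lookup X f ≡ zer →
                               lookup A e ≡ lookup B e → lookup A e ≢ zer → ¬ Sep A B f
    no-agreeing-and-opposite A B {e} {f} LA LB Xe≡0 Xf≡0 Ae≡Be Ae≢0 (Af≡-Bf , Af≢0)
      with elimination-above {X} f (L2 X A LX LA) (L2 X B LX LB)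
             (trans (lookup-∘ₛ-zer X A Xf≡0) (trans Af≡-Bf (cong negS (sym (lookup-∘ₛ-zer X B Xf≡0)))) ,
              Af≢0 ∘ trans (sym (lookup-∘ₛ-zer X A Xf≡0)))
             (≼-∘ₛ X A) (≼-∘ₛ X B)
    ... | Z , LZ , Zf≡0 , Z-agrees , X≼Z =
      no-partial-vanishing Z LZ X≼Z Xf≡0 Xe≡0 Zf≡0 (Ae≢0 ∘ trans (sym Ze≡Ae))
      where
      open ≡-Reasoning
      XAe≡Ae : lookup (X ∘ₛ A) e ≡ lookup A e
      XAe≡Ae = lookup-∘ₛ-zer X A Xe≡0
      Ze≡Ae : lookup Z e ≡ lookup A e
      Ze≡Ae = begin
        lookup Z e                         ≡⟨ Z-agrees e (≡⇒¬Sep {X = X ∘ₛ A} {Y = X ∘ₛ B} XAe≡XBe) ⟩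
        lookup ((X ∘ₛ A) ∘ₛ (X ∘ₛ B)) e    ≡⟨ lookup-∘ₛ-≢zer (X ∘ₛ A) (X ∘ₛ B) (Ae≢0 ∘ trans (sym XAe≡Ae)) ⟩
        lookup (X ∘ₛ A) e                  ≡⟨ XAe≡Ae ⟩
        lookup A e                         ∎
        where
        XAe≡XBe : lookup (X ∘ₛ A) e ≡ lookup (X ∘ₛ B) e
        XAe≡XBe = trans XAe≡Ae (trans Ae≡Be (sym (lookup-∘ₛ-zer X B Xe≡0)))

    -- Simplicity gives covectors Y and Y′ showing that e and f are neither parallel nor
    -- antiparallel; after possibly negating Y, the two agree at e and are opposite at f.
    single-zero : ∀ {e f} → e ≢ f → lookup X e ≡ zer → lookup X f ≡ zer → ⊥
    single-zero {e} {f} e≢f Xe≡0 Xf≡0 with proj₁ (proj₂ simple) e f e≢f | proj₂ (proj₂ simple) e f e≢f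
    ... | Y , LY , Ye≢Yf | Y' , LY' , Y'e≢-Y'f = orient (lookup Y f ≟ₛ negS (lookup Y' f))
      where
      Ye≢0 : lookup Y e ≢ zer
      Ye≢0 Ye≡0 = Ye≢Yf (trans Ye≡0 (sym (vanish-together Y LY Xe≡0 Xf≡0 Ye≡0)))
      Yf≢0 : lookup Y f ≢ zer
      Yf≢0 Yf≡0 = Ye≢0 (vanish-together Y LY Xf≡0 Xe≡0 Yf≡0)
      Y'e≢0 : lookup Y' e ≢ zer
      Y'e≢0 Y'e≡0 = Y'e≢-Y'f (trans Y'e≡0 (sym (cong negS (vanish-together Y' LY' Xe≡0 Xf≡0 Y'e≡0))))
      Y'f≢0 : lookup Y' f ≢ zer
      Y'f≢0 Y'f≡0 = Y'e≢0 (vanish-together Y' LY' Xf≡0 Xe≡0 Y'f≡0)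
      Ye≡-Yf : lookup Y e ≡ negS (lookup Y f)
      Ye≡-Yf = ≢⇒≡negS Ye≢0 Yf≢0 Ye≢Yf
      Y'e≡Y'f : lookup Y' e ≡ lookup Y' f
      Y'e≡Y'f = ≢negS⇒≡ Y'e≢0 Y'f≢0 Y'e≢-Y'f
      orient : Dec (lookup Y f ≡ negS (lookup Y' f)) → ⊥
      orient (yes Yf≡-Y'f) = no-agreeing-and-opposite Y Y' LY LY' Xe≡0 Xf≡0
        (trans Ye≡-Yf (trans (cong negS Yf≡-Y'f) (trans (negS-involutive _) (sym Y'e≡Y'f)))) Ye≢0
        (Yf≡-Y'f , Yf≢0)
      orient (no Yf≢-Y'f) = no-agreeing-and-opposite (neg Y) Y' (L1 Y LY) LY' Xe≡0 Xf≡0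
        (trans (lookup-neg Y e) (trans (cong negS Ye≡-Yf) (trans (negS-involutive _) (trans Yf≡Y'f (sym Y'e≡Y'f)))))
        (negS-≢zer Ye≢0 ∘ trans (sym (lookup-neg Y e)))
        (trans (lookup-neg Y f) (cong negS Yf≡Y'f) , negS-≢zer Yf≢0 ∘ trans (sym (lookup-neg Y f)))
        where
        Yf≡Y'f : lookup Y f ≡ lookup Y' f
        Yf≡Y'f = ≢negS⇒≡ Yf≢0 Y'f≢0 Yf≢-Y'f

  adjacent⇒single-separator : Simple L → ∀ {T T'} → Adjacent L T T' →
                              ∃[ e ] (Sep T T' e × (∀ h → h ≢ e → lookup T h ≡ lookup T' h))
  adjacent⇒single-separator simple {T} {T'} (tope-T , tope-T' , T≢T' , X , LX , X⋖T , X⋖T')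
    with any? (λ e → lookup X e ≟ₛ zer)
  ... | no X-full = ⊥-elim (proj₂ (proj₁ X⋖T) (lookup-extensionality λ e →
                      sym (≼-≢zer {X = X} {Y = T} (proj₁ (proj₁ X⋖T)) (X-full ∘ (e ,_)))))
  ... | yes (e , Xe≡0) = e , (≢⇒≡negS (T-full e) (T'-full e) (T≢T' ∘ T≡T') , T-full e) , T≗T'
    where
    open Covering simple LX tope-T X⋖T
    T-full : ∀ h → lookup T h ≢ zer
    T-full = tope-nonzero (proj₁ simple) tope-T
    T'-full : ∀ h → lookup T' h ≢ zer
    T'-full = tope-nonzero (proj₁ simple) tope-T'
    T≗T' : ∀ h → h ≢ e → lookup T h ≡ lookup T' h
    T≗T' h h≢e = trans (≼-≢zer {X = X} {Y = T} (proj₁ (proj₁ X⋖T)) Xh≢0)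
                       (sym (≼-≢zer {X = X} {Y = T'} (proj₁ (proj₁ X⋖T')) Xh≢0))
      where
      Xh≢0 : lookup X h ≢ zer
      Xh≢0 Xh≡0 = single-zero h≢e Xh≡0 Xe≡0
    T≡T' : lookup T e ≡ lookup T' e → T ≡ T'
    T≡T' Te≡T'e = lookup-extensionality λ h → agree h (h ≟ᶠ e)
      where
      agree : ∀ h → Dec (h ≡ e) → lookup T h ≡ lookup T' h
      agree h (yes refl) = Te≡T'e
      agree h (no h≢e)   = T≗T' h h≢e

-- Walking along a symmetric cycle

module SymmetricCycleWalk (k : ℕ) {L : SV (suc k) → Set} (om : IsOrientedMatroid L) (simple : Simple L)
                          (T : Fin (suc k + suc k) → SV (suc k)) (cycle : SymmetricCycle L T) where
  open SymmetricCycle cycle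

  m : ℕ
  m = suc k

  d : ℕ
  d = m + m

  t : ℕ → SV m
  t n = T (n mod d)

  toℕ-mod : ∀ n → toℕ (n mod d) ≡ n % d
  toℕ-mod n = toℕ-fromℕ< (m%n<n n d)

  t-cong : ∀ a b → a % d ≡ b % d → t a ≡ t b
  t-cong a b a≡b = cong T (toℕ-injective (trans (toℕ-mod a) (trans a≡b (sym (toℕ-mod b)))))

  t-injective : ∀ a b → t a ≡ t b → a % d ≡ b % d
  t-injective a b ta≡tb = trans (sym (toℕ-mod a)) (trans (cong toℕ (distinct _ _ ta≡tb)) (toℕ-mod b))

  t-toℕ : ∀ i → t (toℕ i) ≡ T i
  t-toℕ i = cong T (toℕ-injective (trans (toℕ-mod (toℕ i)) (m<n⇒m%n≡m (toℕ<n i))))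

  t-tope : ∀ n → Tope L (t n)
  t-tope n = topes (n mod d)

  t-nonzero : ∀ n e → lookup (t n) e ≢ zer
  t-nonzero n = tope-nonzero om (proj₁ simple) (t-tope n)

  t-adjacent : ∀ n → Adjacent L (t n) (t (suc n))
  t-adjacent n = adjacent (n mod d) (suc n mod d) successor
    where
    suc-n%d : suc n % d ≡ suc (n % d) % d
    suc-n%d = sym ([m+n%d]%d≡[m+n]%d 1 n d)
    successor : toℕ (suc n mod d) ≡ suc (toℕ (n mod d)) ⊎
                (toℕ (suc n mod d) ≡ 0 × suc (toℕ (n mod d)) ≡ d)
    successor rewrite toℕ-mod n | toℕ-mod (suc n) with m≤n⇒m<n∨m≡n (m%n<n n d)
    ... | inj₁ 1+r<d = inj₁ (trans suc-n%d (m<n⇒m%n≡m 1+r<d))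
    ... | inj₂ 1+r≡d = inj₂ (trans suc-n%d (trans (cong (_% d) 1+r≡d) (n%n≡0 d)) , 1+r≡d)

  t-antipodal-lower : ∀ {r} → r < m → t (r + m) ≡ neg (t r)
  t-antipodal-lower {r} r<m = symmetric (r mod d) ((r + m) mod d) (begin
    toℕ ((r + m) mod d)   ≡⟨ toℕ-mod (r + m) ⟩
    (r + m) % d           ≡⟨ m<n⇒m%n≡m (+-monoˡ-< m r<m) ⟩
    r + m                 ≡⟨ cong (_+ m) (trans (toℕ-mod r) (m<n⇒m%n≡m (<-trans r<m (m<m+n m z<s)))) ⟨
    toℕ (r mod d) + m     ∎)
    where open ≡-Reasoning

  t-antipodal : ∀ n → t (n + m) ≡ neg (t n)
  t-antipodal n with lower-or-upper-half {m} (m%n<n n d)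
  ... | inj₁ r<m = begin
    t (n + m)          ≡⟨ t-cong (n % d + m) (n + m) ([m%d+n]%d≡[m+n]%d n m d) ⟨
    t (n % d + m)      ≡⟨ t-antipodal-lower r<m ⟩
    neg (t (n % d))    ≡⟨ cong neg (t-cong (n % d) n (m%n%n≡m%n n d)) ⟩
    neg (t n)          ∎
    where open ≡-Reasoning
  ... | inj₂ (r , r<m , n%d≡r+m) = begin
    t (n + m)          ≡⟨ t-cong (n % d + m) (n + m) ([m%d+n]%d≡[m+n]%d n m d) ⟨
    t (n % d + m)      ≡⟨ cong (λ x → t (x + m)) n%d≡r+m ⟩
    t (r + m + m)      ≡⟨ cong t (+-assoc r m m) ⟩
    t (r + d)          ≡⟨ t-cong (r + d) r ([m+n]%n≡m%n r d) ⟩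
    t r                ≡⟨ neg-involutive (t r) ⟨
    neg (neg (t r))    ≡⟨ cong neg (t-antipodal-lower r<m) ⟨
    neg (t (r + m))    ≡⟨ cong (neg ∘ t) n%d≡r+m ⟨
    neg (t (n % d))    ≡⟨ cong neg (t-cong (n % d) n (m%n%n≡m%n n d)) ⟩
    neg (t n)          ∎
    where open ≡-Reasoning

  abstract
    flip : ℕ → Fin m
    flip n = proj₁ (adjacent⇒single-separator om simple (t-adjacent n))

    flip-separates : ∀ n → Sep (t n) (t (suc n)) (flip n)
    flip-separates n = proj₁ (proj₂ (adjacent⇒single-separator om simple (t-adjacent n)))

    flip-only : ∀ n h → h ≢ flip n → lookup (t n) h ≡ lookup (t (suc n)) h
    flip-only n = proj₂ (proj₂ (adjacent⇒single-separator om simple (t-adjacent n)))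

  flip-negates : ∀ n → lookup (t (suc n)) (flip n) ≡ negS (lookup (t n) (flip n))
  flip-negates n = proj₁ (Sep-sym {X = t n} {Y = t (suc n)} (flip-separates n))

  separator-unique : ∀ n h → Sep (t n) (t (suc n)) h → h ≡ flip n
  separator-unique n h sep with h ≟ᶠ flip n
  ... | yes h≡flip = h≡flip
  ... | no h≢flip  = contradiction sep (≡⇒¬Sep {X = t n} {Y = t (suc n)} (flip-only n h h≢flip))

  separated-exactly-by-flip : ∀ n f → Sep (t n) (t (suc n)) f ⇔ f ≡ flip n
  separated-exactly-by-flip n f = mk⇔ (separator-unique n f) λ { refl → flip-separates n }

  flip-cong : ∀ a b → a % d ≡ b % d → flip a ≡ flip b
  flip-cong a b a≡b = separator-unique b (flip a)
    (subst₂ (λ X Y → Sep X Y (flip a)) (t-cong a b a≡b) (t-cong (suc a) (suc b) (+-%-congˡ 1 d a≡b))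
            (flip-separates a))

  flip-antipodal : ∀ n → flip (n + m) ≡ flip n
  flip-antipodal n = separator-unique n (flip (n + m)) (Sep-neg {X = t n} {Y = t (suc n)}
    (subst₂ (λ X Y → Sep X Y (flip (n + m))) (t-antipodal n) (t-antipodal (suc n)) (flip-separates (n + m))))

  unflipped-constant : ∀ a j h → (∀ i → i < j → flip (a + i) ≢ h) → lookup (t (a + j)) h ≡ lookup (t a) h
  unflipped-constant a zero    h _         = cong (λ n → lookup (t n) h) (+-identityʳ a)
  unflipped-constant a (suc j) h unflipped = begin
    lookup (t (a + suc j)) h     ≡⟨ cong (λ n → lookup (t n) h) (+-suc a j) ⟩
    lookup (t (suc (a + j))) h   ≡⟨ flip-only (a + j) h (unflipped j ≤-refl ∘ sym) ⟨
    lookup (t (a + j)) h         ≡⟨ unflipped-constant a j h (λ i i<j → unflipped i (m≤n⇒m≤1+n i<j)) ⟩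
    lookup (t a) h               ∎
    where open ≡-Reasoning

  flip-surjective : ∀ a h → ∃ λ i → i < m × flip (a + i) ≡ h
  flip-surjective a h with anyUpTo? (λ i → flip (a + i) ≟ᶠ h) m
  ... | yes found = found
  ... | no none   = contradiction (≡negS⇒zer (begin
    lookup (t a) h          ≡⟨ unflipped-constant a m h (λ i i<m flip≡h → none (i , i<m , flip≡h)) ⟨
    lookup (t (a + m)) h    ≡⟨ cong (λ X → lookup X h) (t-antipodal a) ⟩
    lookup (neg (t a)) h    ≡⟨ lookup-neg (t a) h ⟩
    negS (lookup (t a) h)   ∎)) (t-nonzero a h)
    where open ≡-Reasoning

  flip-injective : ∀ a {i j} → i < m → j < m → flip (a + i) ≡ flip (a + j) → i ≡ j
  flip-injective a {i} {j} i<m j<m flip≡flip = begin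
    i                   ≡⟨ toℕ-fromℕ< i<m ⟨
    toℕ (fromℕ< i<m)    ≡⟨ cong toℕ (surjective⇒injective g g-surjective g≡g) ⟩
    toℕ (fromℕ< j<m)    ≡⟨ toℕ-fromℕ< j<m ⟩
    j                   ∎
    where
    open ≡-Reasoning
    g : Fin m → Fin m
    g x = flip (a + toℕ x)
    g-fromℕ< : ∀ {n} (n<m : n < m) → g (fromℕ< n<m) ≡ flip (a + n)
    g-fromℕ< n<m = cong (λ n → flip (a + n)) (toℕ-fromℕ< n<m)
    g-surjective : ∀ h → ∃ λ x → g x ≡ h
    g-surjective h with flip-surjective a h
    ... | n , n<m , flip≡h = fromℕ< n<m , trans (g-fromℕ< n<m) flip≡h
    g≡g : g (fromℕ< i<m) ≡ g (fromℕ< j<m)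
    g≡g = trans (g-fromℕ< i<m) (trans flip≡flip (sym (g-fromℕ< j<m)))

  flip-persists : ∀ a {j} → j < m → lookup (t (suc a + j)) (flip a) ≡ lookup (t (suc a)) (flip a)
  flip-persists a {j} j<m = unflipped-constant (suc a) j (flip a) λ i i<j flip≡flip →
    0≢1+n (flip-injective a z<s (≤-<-trans i<j j<m)
      (trans (cong flip (+-identityʳ a)) (trans (sym flip≡flip) (cong flip (sym (+-suc a i))))))

  flip-reverts : ∀ a {j} → j < m → lookup (t (suc a + j + m)) (flip a) ≡ negS (lookup (t (suc a)) (flip a))
  flip-reverts a {j} j<m = begin
    lookup (t (suc a + j + m)) (flip a)      ≡⟨ cong (λ X → lookup X (flip a)) (t-antipodal (suc a + j)) ⟩
    lookup (neg (t (suc a + j))) (flip a)    ≡⟨ lookup-neg (t (suc a + j)) (flip a) ⟩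
    negS (lookup (t (suc a + j)) (flip a))   ≡⟨ cong negS (flip-persists a j<m) ⟩
    negS (lookup (t (suc a)) (flip a))       ∎
    where open ≡-Reasoning

  rises : ℕ → Bool
  rises n = isPlus (lookup (t (suc n)) (flip n))

  rises-cong : ∀ a b → a % d ≡ b % d → rises a ≡ rises b
  rises-cong a b a≡b =
    cong₂ (λ X h → isPlus (lookup X h)) (t-cong (suc a) (suc b) (+-%-congˡ 1 d a≡b)) (flip-cong a b a≡b)

  rises-antipodal : ∀ n → rises (n + m) ≡ not (rises n)
  rises-antipodal n = begin
    isPlus (lookup (t (suc n + m)) (flip (n + m)))
      ≡⟨ cong₂ (λ X h → isPlus (lookup X h)) (t-antipodal (suc n)) (flip-antipodal n) ⟩
    isPlus (lookup (neg (t (suc n))) (flip n))       ≡⟨ cong isPlus (lookup-neg (t (suc n)) (flip n)) ⟩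
    isPlus (negS (lookup (t (suc n)) (flip n)))      ≡⟨ isPlus-negS (t-nonzero (suc n) (flip n)) ⟩
    not (rises n)                                    ∎
    where open ≡-Reasoning

  not-rises : ∀ n → not (rises n) ≡ isPlus (lookup (t n) (flip n))
  not-rises n = begin
    not (isPlus (lookup (t (suc n)) (flip n)))          ≡⟨ cong (not ∘ isPlus) (flip-negates n) ⟩
    not (isPlus (negS (lookup (t n) (flip n))))         ≡⟨ cong not (isPlus-negS (t-nonzero n (flip n))) ⟩
    not (not (isPlus (lookup (t n) (flip n))))          ≡⟨ not-involutive _ ⟩
    isPlus (lookup (t n) (flip n))                      ∎
    where open ≡-Reasoning

  -- peak q: the tope t (suc q) is entered by a rising step and left by a falling one.
  peak : ℕ → Bool
  peak = peakOf rises

  peak⇔ : ∀ q → peak q ≡ true ⇔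
                (lookup (t (suc q)) (flip q) ≡ plus × lookup (t (suc q)) (flip (suc q)) ≡ plus)
  peak⇔ q = mk⇔ (to isPlus-∧⇔ ∘ trans (sym peak≡)) (trans peak≡ ∘ from isPlus-∧⇔)
    where
    peak≡ : peak q ≡ isPlus (lookup (t (suc q)) (flip q)) ∧ isPlus (lookup (t (suc q)) (flip (suc q)))
    peak≡ = cong (rises q ∧_) (not-rises (suc q))

  peak-cong : ∀ a b → a % d ≡ b % d → peak a ≡ peak b
  peak-cong a b a≡b =
    cong₂ (λ x y → x ∧ not y) (rises-cong a b a≡b) (rises-cong (suc a) (suc b) (+-%-congˡ 1 d a≡b))

  peak-antipodal : ∀ n → peak (n + m) ≡ valleyOf rises n
  peak-antipodal n = trans (cong₂ (λ x y → x ∧ not y) (rises-antipodal n) (rises-antipodal (suc n)))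
                           (cong (not (rises n) ∧_) (not-involutive _))

  peak-window-unique : ∀ q → peak q ≡ true → ∀ j → j < d →
    lookup (t (suc q + j)) (flip q) ≡ plus → lookup (t (suc q + j)) (flip (suc q)) ≡ plus → j ≡ 0
  peak-window-unique q pk zero    _   _     _      = refl
  peak-window-unique q pk (suc j) j<d at-q at-q+1 with to (peak⇔ q) pk | lower-or-upper-half {m} j<d
  ... | _ , leaving | inj₁ 1+j<m = contradiction (trans (sym at-q+1) (begin
    lookup (t (suc q + suc j)) (flip (suc q))       ≡⟨ cong (λ n → lookup (t n) (flip (suc q))) (+-suc (suc q) j) ⟩
    lookup (t (suc (suc q) + j)) (flip (suc q))     ≡⟨ flip-persists (suc q) (<-trans (n<1+n j) 1+j<m) ⟩
    lookup (t (suc (suc q))) (flip (suc q))         ≡⟨ flip-negates (suc q) ⟩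
    negS (lookup (t (suc q)) (flip (suc q)))        ≡⟨ cong negS leaving ⟩
    negS plus                                       ∎)) λ ()
    where open ≡-Reasoning
  ... | entering , _ | inj₂ (j' , j'<m , 1+j≡j'+m) = contradiction (trans (sym at-q) (begin
    lookup (t (suc q + suc j)) (flip q)             ≡⟨ cong (λ n → lookup (t (suc q + n)) (flip q)) 1+j≡j'+m ⟩
    lookup (t (suc q + (j' + m))) (flip q)          ≡⟨ cong (λ n → lookup (t n) (flip q)) (+-assoc (suc q) j' m) ⟨
    lookup (t (suc q + j' + m)) (flip q)            ≡⟨ flip-reverts q j'<m ⟩
    negS (lookup (t (suc q)) (flip q))              ≡⟨ cong negS entering ⟩
    negS plus                                       ∎)) λ ()
    where open ≡-Reasoning

  V : SV m → Set
  V X = ∃[ i ] (T i ≡ X)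

  Kstar : SV m → Set
  Kstar = maxPlus V

  Kstar⁺ : Fin m → SV m → Set
  Kstar⁺ h X = Kstar X × lookup X h ≡ plus

  LocallyMaxPlus : SV m → Set
  LocallyMaxPlus X = ∀ S e → V S → (∀ f → Sep S X f ⇔ f ≡ e) → lookup X e ≡ plus

  V-t : ∀ n → V (t n)
  V-t n = n mod d , refl

  V-tope : ∀ X → V X → Tope L X
  V-tope X (i , refl) = topes i

  V-window : ∀ a {X} → V X → ∃ λ j → j < d × t (a + j) ≡ X
  V-window a (i , refl) with +-%-surjective a (toℕ i) d
  ... | j , j<d , a+j≡i = j , j<d , trans (t-cong (a + j) (toℕ i) a+j≡i) (t-toℕ i)

  only-peak-positive-on-flips : ∀ q → peak q ≡ true → ∀ {Y} → V Y →
    lookup Y (flip q) ≡ plus → lookup Y (flip (suc q)) ≡ plus → Y ≡ t (suc q)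
  only-peak-positive-on-flips q pk VY Yq≡+ Yq+1≡+ with V-window (suc q) VY
  ... | j , j<d , refl with peak-window-unique q pk j j<d Yq≡+ Yq+1≡+
  ... | refl = cong t (+-identityʳ (suc q))

  peak⇒Kstar : ∀ q → peak q ≡ true → Kstar (t (suc q))
  peak⇒Kstar q pk = V-t (suc q) , λ R VR (t⊆R , e , Re≡+ , te≢+) →
    te≢+ (subst (λ X → lookup X e ≡ plus)
                (only-peak-positive-on-flips q pk VR (t⊆R (flip q) entering) (t⊆R (flip (suc q)) leaving)) Re≡+)
    where
    entering : lookup (t (suc q)) (flip q) ≡ plus
    entering = proj₁ (to (peak⇔ q) pk)
    leaving : lookup (t (suc q)) (flip (suc q)) ≡ plus
    leaving  = proj₂ (to (peak⇔ q) pk)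

  Kstar⇒LocallyMaxPlus : ∀ X → Kstar X → LocallyMaxPlus X
  Kstar⇒LocallyMaxPlus X (VX , maximal) S e VS separators with lookup X e ≟ₛ plus
  ... | yes Xe≡+ = Xe≡+
  ... | no Xe≢+  = ⊥-elim (maximal S VS
    (⊊⁺-of-single-separator {X = X} {S = S} (tope-nonzero om (proj₁ simple) (V-tope X VX))
                             (tope-nonzero om (proj₁ simple) (V-tope S VS)) separators Xe≢+))

  LocallyMaxPlus⇒peak : ∀ X → V X → LocallyMaxPlus X → ∃ λ q → peak q ≡ true × t (suc q) ≡ X
  LocallyMaxPlus⇒peak X VX local-max with V-window 1 VX
  ... | q , _ , refl = q , from (peak⇔ q) (entering , leaving) , refl
    where
    entering : lookup (t (suc q)) (flip q) ≡ plus
    entering = local-max (t q) (flip q) (V-t q) (separated-exactly-by-flip q)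
    leaving : lookup (t (suc q)) (flip (suc q)) ≡ plus
    leaving  = local-max (t (suc (suc q))) (flip (suc q)) (V-t (suc (suc q))) λ f →
      mk⇔ (separator-unique (suc q) f ∘ Sep-sym {X = t (suc (suc q))} {Y = t (suc q)})
          (λ { refl → Sep-sym {X = t (suc q)} {Y = t (suc (suc q))} (flip-separates (suc q)) })

  Kstar⇔LocallyMaxPlus : ∀ X → Kstar X ⇔ (V X × LocallyMaxPlus X)
  Kstar⇔LocallyMaxPlus X = mk⇔ (λ KX → proj₁ KX , Kstar⇒LocallyMaxPlus X KX) λ (VX , local-max) →
    let q , pk , t[1+q]≡X = LocallyMaxPlus⇒peak X VX local-max in subst Kstar t[1+q]≡X (peak⇒Kstar q pk)

  Kstar⇒peak-in-window : ∀ a {X} → Kstar X → ∃ λ j → j < d × peak (a + j) ≡ true × t (suc (a + j)) ≡ X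
  Kstar⇒peak-in-window a {X} KX with LocallyMaxPlus⇒peak X (proj₁ KX) (Kstar⇒LocallyMaxPlus X KX)
  ... | q , pk , refl with +-%-surjective a q d
  ... | j , j<d , a+j≡q =
    j , j<d , trans (peak-cong (a + j) q a+j≡q) pk , t-cong (suc (a + j)) (suc q) (+-%-congˡ 1 d a+j≡q)

  Kstar-unique-on-flips : ∀ X → Kstar X → ∃₂ λ e f →
                            ∀ Y → Kstar Y → lookup Y e ≡ plus → lookup Y f ≡ plus → Y ≡ X
  Kstar-unique-on-flips X KX with LocallyMaxPlus⇒peak X (proj₁ KX) (Kstar⇒LocallyMaxPlus X KX)
  ... | q , pk , refl = flip q , flip (suc q) , λ Y KY → only-peak-positive-on-flips q pk (proj₁ KY)

  peaks : ℕ → ℕ → List (SV m)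
  peaks = select peak (t ∘ suc)

  peaks-unique : ∀ a L → L ≤ d → Unique (peaks a L)
  peaks-unique a L L≤d = select-unique peak (t ∘ suc) a L λ {i} {j} i<j j<L t≡t →
    [m+i]%d≢[m+j]%d (suc a) d i<j (<-≤-trans j<L L≤d) (t-injective (suc (a + i)) (suc (a + j)) t≡t)

  Kstar-size : ∀ a → HasSize Kstar (count peak a d)
  Kstar-size a =
    peaks a d , peaks-unique a d ≤-refl , length-select peak (t ∘ suc) a d , λ _ → mk⇔ peak∈⇒K K⇒peak∈
    where
    peak∈⇒K : ∀ {X} → X ∈ peaks a d → Kstar X
    peak∈⇒K X∈ with ∈-select⁻ peak (t ∘ suc) a d X∈
    ... | i , _ , pk , refl = peak⇒Kstar (a + i) pk
    K⇒peak∈ : ∀ {X} → Kstar X → X ∈ peaks a d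
    K⇒peak∈ KX with Kstar⇒peak-in-window a KX
    ... | j , j<d , pk , refl = ∈-select⁺ peak (t ∘ suc) a d j j<d pk

  -- The element turned positive at step u stays positive on the next m topes and is negative on
  -- the m after them, so the peaks positive at it are those among the m topes following step u.
  Kstar⁺-size : ∀ u → rises u ≡ true → HasSize (Kstar⁺ (flip u)) (count peak u m)
  Kstar⁺-size u rise =
    peaks u m , peaks-unique u m (m≤m+n m m) , length-select peak (t ∘ suc) u m , λ _ → mk⇔ peak∈⇒K⁺ K⁺⇒peak∈
    where
    entered : lookup (t (suc u)) (flip u) ≡ plus
    entered = to isPlus⇔ rise
    peak∈⇒K⁺ : ∀ {X} → X ∈ peaks u m → Kstar⁺ (flip u) X
    peak∈⇒K⁺ X∈ with ∈-select⁻ peak (t ∘ suc) u m X∈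
    ... | i , i<m , pk , refl = peak⇒Kstar (u + i) pk , trans (flip-persists u i<m) entered
    K⁺⇒peak∈ : ∀ {X} → Kstar⁺ (flip u) X → X ∈ peaks u m
    K⁺⇒peak∈ (KX , Xu≡+) with Kstar⇒peak-in-window u KX
    ... | j , j<d , pk , refl with lower-or-upper-half {m} j<d
    ...   | inj₁ j<m = ∈-select⁺ peak (t ∘ suc) u m j j<m pk
    ...   | inj₂ (j' , j'<m , refl) = contradiction (trans (sym Xu≡+) (begin
      lookup (t (suc (u + (j' + m)))) (flip u)   ≡⟨ cong (λ n → lookup (t (suc n)) (flip u)) (+-assoc u j' m) ⟨
      lookup (t (suc u + j' + m)) (flip u)       ≡⟨ flip-reverts u j'<m ⟩
      negS (lookup (t (suc u)) (flip u))         ≡⟨ cong negS entered ⟩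
      negS plus                                  ∎)) λ ()
      where open ≡-Reasoning

  peaks-halves : ∀ u → rises u ≡ true → count peak u m ≡ suc (count peak (u + m) m)
  peaks-halves u rise = begin
    count peak u m                                ≡⟨ +-identityʳ _ ⟨
    count peak u m + bit false                    ≡⟨ cong (λ b → count peak u m + bit b) falls ⟨
    count peak u m + bit (rises (u + m))          ≡⟨ peaks-balance rises u m ⟩
    count (valleyOf rises) u m + bit (rises u)    ≡⟨ cong₂ (λ c b → c + bit b) valleys≡peaks rise ⟩
    count peak (u + m) m + 1                      ≡⟨ +-comm _ 1 ⟩
    suc (count peak (u + m) m)                    ∎
    where
    open ≡-Reasoning
    falls : rises (u + m) ≡ false
    falls = trans (rises-antipodal u) (cong not rise)
    valleys≡peaks : count (valleyOf rises) u m ≡ count peak (u + m) m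
    valleys≡peaks = count-cong (valleyOf rises) peak u (u + m) m λ i _ →
      sym (trans (cong peak (xy∙z≈xz∙y u m i)) (peak-antipodal (u + i)))

  Kstar-size-odd : ∀ u → rises u ≡ true → HasSize Kstar (suc (count peak (u + m) m + count peak (u + m) m))
  Kstar-size-odd u rise =
    subst (HasSize Kstar) (trans (count-++ peak u m m) (cong (_+ count peak (u + m) m) (peaks-halves u rise))) (Kstar-size u)

  rising-flip : ∀ h → ∃ λ u → flip u ≡ h × rises u ≡ true
  rising-flip h with flip-surjective 0 h
  ... | i , _ , flip≡h with rises i in rise
  ...   | true  = i , flip≡h , rise
  ...   | false = i + m , trans (flip-antipodal i) flip≡h , trans (rises-antipodal i) (cong not rise)

  Kstar-counts : ∃ λ c → HasSize Kstar (suc (c + c)) × (∀ h → HasSize (Kstar⁺ h) (suc c))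
  Kstar-counts with rising-flip Fin.zero
  ... | u₀ , _ , rise₀ = c , Kstar-size-odd u₀ rise₀ , Kstar⁺-size-c
    where
    c : ℕ
    c = count peak (u₀ + m) m
    Kstar⁺-size-c : ∀ h → HasSize (Kstar⁺ h) (suc c)
    Kstar⁺-size-c h with rising-flip h
    ... | u , refl , rise =
      subst (HasSize (Kstar⁺ (flip u))) (trans (peaks-halves u rise) (cong suc cᵤ≡c)) (Kstar⁺-size u rise)
      where
      cᵤ : ℕ
      cᵤ = count peak (u + m) m
      cᵤ≡c : cᵤ ≡ c
      cᵤ≡c = begin
        cᵤ               ≡⟨ n≡⌊n+n/2⌋ cᵤ ⟩
        ⌊ cᵤ + cᵤ /2⌋    ≡⟨ cong ⌊_/2⌋ (suc-injective (HasSize-unique (Kstar-size-odd u rise)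
                                                                      (Kstar-size-odd u₀ rise₀))) ⟩
        ⌊ c + c /2⌋      ≡⟨ n≡⌊n+n/2⌋ c ⟨
        c                ∎
        where open ≡-Reasoning

mainTheorem7 : (m : ℕ) (L : SV m → Set) → IsOrientedMatroid L → RankAtLeast2 L → Simple L →
  (T : Fin (m + m) → SV m) → SymmetricCycle L T →
  let V : SV m → Set
      V X = ∃[ k ] (T k ≡ X)
      Kstar : SV m → Set
      Kstar = maxPlus V
  in (∀ X → Kstar X ⇔ (V X × (∀ S e → V S → (∀ f → Sep S X f ⇔ f ≡ e) → lookup X e ≡ plus)))
     × CriticalCommittee L Kstar
     × ∃[ n ] (HasSize Kstar n ×
               (∀ e → HasSize (λ K → Kstar K × lookup K e ≡ plus) ⌈ n /2⌉))
mainTheorem7 zero L om ([] , _ , _ , _ , (_ , 0≢X) , _) simple T cycle = ⊥-elim (0≢X refl)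
mainTheorem7 (suc k) L om _ simple T cycle =
  let open SymmetricCycleWalk k om simple T cycle
      c , K-size , K⁺-size = Kstar-counts
  in Kstar⇔LocallyMaxPlus ,
     ((odd-majority⇒committee (λ X → V-tope X ∘ proj₁) K-size K⁺-size ,
       unique-on-pair⇒minimal Kstar-unique-on-flips) ,
      λ X T' KX _ → tight-majority⇒critical K-size K⁺-size X T' KX) ,
     suc (c + c) , K-size , λ e → subst (HasSize (Kstar⁺ e)) (cong suc (n≡⌊n+n/2⌋ c)) (K⁺-size e)
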